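{- Every oriented-disc graph is isomorphic to the revealed preference graph of some consumer data set in a three-commodity market, i.e. for every oriented-disc graph $D$ on $n$ vertices there exist $(\vec p_1,\vec x_1),\dots,(\vec p_n,\vec x_n)\in\mathbb{R}_{\ge0}^3\times\mathbb{R}_{\ge0}^3$ whose revealed preference graph $D_\succeq$ is isomorphic to $D$.
   Context: An oriented-disc drawing consists of points $\vec x_1,\dots,\vec x_n$ in the plane and closed discs $B_1,\dots,B_n$ (of possibly varying radii) such that $\vec x_i$ lies on the boundary of $B_i$. Its oriented-disc graph is the digraph on $\{\vec x_1,\dots,\vec x_n\}$ with an arc from $\vec x_i$ to $\vec x_j$ ($j\ne i$) iff $\vec x_j\in B_i$; a digraph is an oriented-disc graph if it arises this way. For consumer data $(\vec p_i,\vec x_i)$, the revealed preference graph $D_\succeq$ has a vertex for each data pair and an arc from $\vec x_i$ to $\vec x_j$ ($j\ne i$) iff $\vec p_i\cdot\vec x_i\ge\vec p_i\cdot\vec x_j$. -}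

module Defs where

open import Data.Nat using (ℕ)
open import Data.Fin using (Fin; zero; suc)
open import Data.Product using (Σ; _×_; _,_)
open import Relation.Nullary using (¬_)
open import Relation.Binary.PropositionalEquality using (_≡_; _≢_)
open import Relation.Binary.Structures using (IsTotalOrder)
open import Algebra.Structures using (IsCommutativeRing)
open import Function.Bundles using (_↔_; _⇔_; Inverse)

-- The real numbers, axiomatised as a (Dedekind-)complete ordered field.
-- ℝ is the unique model of these axioms up to isomorphism.
record CompleteOrderedField : Set₁ where
  infixl 6 _+_
  infixl 7 _*_
  infix 4 _≤_
  field
    R   : Set
    _+_ _*_ : R → R → R
    -_  : R → R
    0# 1# : R
    _≤_ : R → R → Set
    isCommutativeRing : IsCommutativeRing _≡_ _+_ _*_ -_ 0# 1#
    0≢1       : 0# ≢ 1#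
    inverse   : ∀ x → x ≢ 0# → Σ R (λ y → x * y ≡ 1#)
    isTotalOrder : IsTotalOrder _≡_ _≤_
    +-mono-≤  : ∀ {x y} z → x ≤ y → x + z ≤ y + z
    *-nonneg  : ∀ {x y} → 0# ≤ x → 0# ≤ y → 0# ≤ x * y
    sup : (S : R → Set) → Σ R S → Σ R (λ b → ∀ x → S x → x ≤ b) →
          Σ R (λ s → (∀ x → S x → x ≤ s) × (∀ b → (∀ x → S x → x ≤ b) → s ≤ b))

Digraph : ℕ → Set₁
Digraph n = Fin n → Fin n → Set

_≅_ : ∀ {n} → Digraph n → Digraph n → Set
_≅_ {n} G H = Σ (Fin n ↔ Fin n) (λ σ →
  ∀ i j → G i j ⇔ H (Inverse.to σ i) (Inverse.to σ j))

module _ (F : CompleteOrderedField) where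
  open CompleteOrderedField F

  _-_ : R → R → R
  x - y = x + (- y)

  sq : R → R
  sq x = x * x

  Point : Set
  Point = R × R

  record Disc : Set where
    constructor disc
    field
      centre : Point
      radius : R
      radius-nonneg : 0# ≤ radius

  dist² : Point → Point → R
  dist² (a , b) (c , d) = sq (a - c) + sq (b - d)

  _∈D_ : Point → Disc → Set
  x ∈D B = dist² x (Disc.centre B) ≤ sq (Disc.radius B)

  _∈∂D_ : Point → Disc → Set
  x ∈∂D B = dist² x (Disc.centre B) ≡ sq (Disc.radius B)

  record ODDrawing (n : ℕ) : Set where
    field
      pt   : Fin n → Point
      dsc  : Fin n → Disc
      onBoundary : ∀ i → pt i ∈∂D dsc i

  odGraph : ∀ {n} → ODDrawing n → Digraph n
  odGraph Δ i j = i ≢ j × (ODDrawing.pt Δ j ∈D ODDrawing.dsc Δ i)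

  IsOrientedDiscGraph : ∀ {n} → Digraph n → Set
  IsOrientedDiscGraph {n} D = Σ (ODDrawing n) (λ Δ → ∀ i j → D i j ⇔ odGraph Δ i j)

  R³ : Set
  R³ = Fin 3 → R

  NonNeg : R³ → Set
  NonNeg v = ∀ k → 0# ≤ v k

  _·_ : R³ → R³ → R
  p · x = p zero * x zero + p (suc zero) * x (suc zero) + p (suc (suc zero)) * x (suc (suc zero))

  record ConsumerData (n : ℕ) : Set where
    field
      price  : Fin n → R³
      bundle : Fin n → R³
      price-nonneg  : ∀ i → NonNeg (price i)
      bundle-nonneg : ∀ i → NonNeg (bundle i)

  revPrefGraph : ∀ {n} → ConsumerData n → Digraph n
  revPrefGraph C i j = i ≢ j ×
    (ConsumerData.price C i · ConsumerData.bundle C j ≤ ConsumerData.price C i · ConsumerData.bundle C i)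

-- Pick L below every coordinate of a centre and H above every coordinate of a point, and
-- translate the plane by (−L, −L), turning the centres into a_i and the points into y_j.
-- Vertex i gets the price p_i = (2a_i, 1) and the bundle x_i = (h − y_i, |y_i|²), where
-- h = (H − L, H − L); all entries are nonnegative. Expanding,
--   p_i · x_j = |y_j − a_i|² − |a_i|² + 2 a_i · h,
-- in which only the first term depends on j. So p_i · x_j ≤ p_i · x_i iff y_j is no farther
-- from a_i than y_i, i.e. iff the j-th point lies in B_i, whose boundary carries the i-th point.
module Submission where

open import Defs
open import Data.Nat using (ℕ)
open import Data.Fin using (Fin; zero; suc)
open import Data.List using (List; tabulate; _++_)
open import Data.List.Relation.Unary.All using (All)
open import Data.List.Relation.Unary.All.Properties using (++⁻ˡ; ++⁻ʳ; tabulate⁻)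
open import Data.Product using (Σ; _×_; _,_; proj₁; proj₂)
open import Data.Sum using (inj₁; inj₂)
open import Function using (_∘_)
open import Function.Bundles using (_⇔_; mk⇔)
open import Function.Construct.Identity using (↔-id; ⇔-id)
open import Function.Construct.Composition using (_⇔-∘_)
open import Function.Construct.Symmetry using (⇔-sym)
open import Data.Product.Function.NonDependent.Propositional using (_×-⇔_)
open import Relation.Binary.Bundles using (TotalOrder)
open import Relation.Binary.PropositionalEquality
  using (_≡_; refl; sym; trans; subst; subst₂; cong; cong₂; module ≡-Reasoning)
open import Relation.Binary.Structures using (IsTotalOrder)
open import Relation.Unary using (Pred)
open import Algebra.Bundles using (CommutativeRing)

module _ (F : CompleteOrderedField) where
  open CompleteOrderedField F
  open IsTotalOrder isTotalOrder using (total) renaming (trans to ≤-trans)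

  commutativeRing : CommutativeRing _ _
  commutativeRing = record { isCommutativeRing = isCommutativeRing }

  open CommutativeRing commutativeRing
    using (+-assoc; +-comm; +-identityˡ; +-identityʳ; -‿inverseˡ; -‿inverseʳ; *-identityˡ;
           commutativeSemiring; +-commutativeSemigroup)
  open import Algebra.Properties.Ring (CommutativeRing.ring commutativeRing) using (-‿distribˡ-*; -‿distribʳ-*; -‿involutive)
  open import Algebra.Properties.CommutativeSemigroup +-commutativeSemigroup using (interchange)
  open import Algebra.Solver.Ring.NaturalCoefficients.Default commutativeSemiring
    using (solve; _:+_; _:*_; _:=_; con)
  open ≡-Reasoning

  infixl 6 _−_
  _−_ : R → R → R
  _−_ = _-_ F

  totalOrder : TotalOrder _ _ _
  totalOrder = record { isTotalOrder = isTotalOrder }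

  open import Data.List.Extrema totalOrder using (min; max; min≤xs; xs≤max)

  +-cancelʳ-≤ : ∀ {x y} k → x + k ≤ y + k → x ≤ y
  +-cancelʳ-≤ {x} {y} k x+k≤y+k = subst₂ _≤_ (cancel x) (cancel y) (+-mono-≤ (- k) x+k≤y+k)
    where
    cancel : ∀ z → (z + k) − k ≡ z
    cancel z = trans (+-assoc z k (- k)) (trans (cong (z +_) (-‿inverseʳ k)) (+-identityʳ z))

  ≤-transport : ∀ {u u′ v v′ a b} → u + a ≡ v + b → u′ + a ≡ v′ + b → u ≤ u′ → v ≤ v′
  ≤-transport {a = a} {b} e e′ u≤u′ = +-cancelʳ-≤ b (subst₂ _≤_ e e′ (+-mono-≤ a u≤u′))

  ≤-transport-⇔ : ∀ {u u′ v v′ a b} → u + a ≡ v + b → u′ + a ≡ v′ + b → (u ≤ u′) ⇔ (v ≤ v′)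
  ≤-transport-⇔ e e′ = mk⇔ (≤-transport e e′) (≤-transport (sym e) (sym e′))

  x≤y⇒0≤y−x : ∀ {x y} → x ≤ y → 0# ≤ y − x
  x≤y⇒0≤y−x {x} {y} x≤y = subst (_≤ y − x) (-‿inverseʳ x) (+-mono-≤ (- x) x≤y)

  +-nonneg : ∀ {x y} → 0# ≤ x → 0# ≤ y → 0# ≤ x + y
  +-nonneg {x} {y} 0≤x 0≤y = ≤-trans 0≤y (subst (_≤ x + y) (+-identityˡ y) (+-mono-≤ y 0≤x))

  -x*-x≡x*x : ∀ x → (- x) * (- x) ≡ x * x
  -x*-x≡x*x x = begin
    (- x) * (- x)   ≡⟨ sym (-‿distribˡ-* x (- x)) ⟩
    - (x * (- x))   ≡⟨ cong -_ (sym (-‿distribʳ-* x x)) ⟩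
    - (- (x * x))   ≡⟨ -‿involutive (x * x) ⟩
    x * x           ∎

  square-nonneg : ∀ x → 0# ≤ x * x
  square-nonneg x with total 0# x
  ... | inj₁ 0≤x = *-nonneg 0≤x 0≤x
  ... | inj₂ x≤0 = subst (0# ≤_) (-x*-x≡x*x x) (*-nonneg 0≤-x 0≤-x)
    where
    0≤-x : 0# ≤ - x
    0≤-x = subst (0# ≤_) (+-identityˡ (- x)) (x≤y⇒0≤y−x x≤0)

  0≤1 : 0# ≤ 1#
  0≤1 = subst (0# ≤_) (*-identityˡ 1#) (square-nonneg 1#)

  telescope : ∀ u v w → u − w ≡ (u − v) + (v − w)
  telescope u v w = begin
    u − w                   ≡⟨ cong (_− w) (sym (+-identityʳ u)) ⟩
    (u + 0#) − w            ≡⟨ cong (λ z → (u + z) − w) (sym (-‿inverseˡ v)) ⟩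
    (u + (- v + v)) − w     ≡⟨ +-assoc u (- v + v) (- w) ⟩
    u + ((- v + v) − w)     ≡⟨ cong (u +_) (+-assoc (- v) v (- w)) ⟩
    u + (- v + (v − w))     ≡⟨ sym (+-assoc u (- v) (v − w)) ⟩
    (u − v) + (v − w)       ∎

  -- With a = c − L, d = x − c and e = H − x no subtraction is left, so this is a semiring identity.
  coordinate-identity : ∀ L H c x →
    ((c − L) + (c − L)) * (H − x) + (x − L) * (x − L) + (c − L) * (c − L)
      ≡ (x − c) * (x − c) + ((c − L) + (c − L)) * (H − L)
  coordinate-identity L H c x = begin
    (a + a) * e + (x − L) * (x − L) + a * a   ≡⟨ cong (λ s → (a + a) * e + s * s + a * a) x−L≡a+d ⟩
    (a + a) * e + (a + d) * (a + d) + a * a   ≡⟨ completeSquare a d e ⟩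
    d * d + (a + a) * ((a + d) + e)           ≡⟨ cong (λ h → d * d + (a + a) * h) H−L≡a+d+e ⟨
    d * d + (a + a) * (H − L)                 ∎
    where
    a d e : R
    a = c − L
    d = x − c
    e = H − x
    x−L≡a+d : x − L ≡ a + d
    x−L≡a+d = trans (telescope x c L) (+-comm d a)
    H−L≡a+d+e : H − L ≡ (a + d) + e
    H−L≡a+d+e = trans (telescope H x L) (trans (+-comm e (x − L)) (cong (_+ e) x−L≡a+d))
    completeSquare : ∀ a d e → (a + a) * e + (a + d) * (a + d) + a * a ≡ d * d + (a + a) * ((a + d) + e)
    completeSquare = solve 3 (λ a d e →
      (a :+ a) :* e :+ (a :+ d) :* (a :+ d) :+ a :* a := d :* d :+ (a :+ a) :* ((a :+ d) :+ e)) refl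

  coordinates : ∀ {n} → (Fin n → Point F) → List R
  coordinates p = tabulate (proj₁ ∘ p) ++ tabulate (proj₂ ∘ p)

  All-coordinates⁻ : ∀ {ℓ} {P : Pred R ℓ} {n} (p : Fin n → Point F) →
    All P (coordinates p) → ∀ i → P (proj₁ (p i)) × P (proj₂ (p i))
  All-coordinates⁻ p all i = tabulate⁻ (++⁻ˡ _ all) i , tabulate⁻ (++⁻ʳ _ all) i

  module RevealedPreference {n} (Δ : ODDrawing F n) where
    open ODDrawing Δ

    centre : Fin n → Point F
    centre i = Disc.centre (dsc i)

    L H : R
    L = min 0# (coordinates centre)
    H = max 0# (coordinates pt)

    L≤centre : ∀ i → L ≤ proj₁ (centre i) × L ≤ proj₂ (centre i)
    L≤centre = All-coordinates⁻ centre (min≤xs 0# (coordinates centre))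

    pt≤H : ∀ i → proj₁ (pt i) ≤ H × proj₂ (pt i) ≤ H
    pt≤H = All-coordinates⁻ pt (xs≤max 0# (coordinates pt))

    a₁ a₂ : Fin n → R
    a₁ i = proj₁ (centre i) − L
    a₂ i = proj₂ (centre i) − L

    price : Fin n → R³ F
    price i zero             = a₁ i + a₁ i
    price i (suc zero)       = a₂ i + a₂ i
    price i (suc (suc zero)) = 1#

    bundle : Fin n → R³ F
    bundle j zero             = H − proj₁ (pt j)
    bundle j (suc zero)       = H − proj₂ (pt j)
    bundle j (suc (suc zero)) = (proj₁ (pt j) − L) * (proj₁ (pt j) − L) + (proj₂ (pt j) − L) * (proj₂ (pt j) − L)

    price-nonneg : ∀ i → NonNeg F (price i)
    price-nonneg i zero             = let 0≤a = x≤y⇒0≤y−x (proj₁ (L≤centre i)) in +-nonneg 0≤a 0≤a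
    price-nonneg i (suc zero)       = let 0≤a = x≤y⇒0≤y−x (proj₂ (L≤centre i)) in +-nonneg 0≤a 0≤a
    price-nonneg i (suc (suc zero)) = 0≤1

    bundle-nonneg : ∀ j → NonNeg F (bundle j)
    bundle-nonneg j zero             = x≤y⇒0≤y−x (proj₁ (pt≤H j))
    bundle-nonneg j (suc zero)       = x≤y⇒0≤y−x (proj₂ (pt≤H j))
    bundle-nonneg j (suc (suc zero)) = +-nonneg (square-nonneg _) (square-nonneg _)

    consumerData : ConsumerData F n
    consumerData = record
      { price = price ; bundle = bundle ; price-nonneg = price-nonneg ; bundle-nonneg = bundle-nonneg }

    centreNorm² cornerCost : Fin n → R
    centreNorm² i = a₁ i * a₁ i + a₂ i * a₂ i
    cornerCost i = (a₁ i + a₁ i) * (H − L) + (a₂ i + a₂ i) * (H − L)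

    price·bundle : ∀ i j → _·_ F (price i) (bundle j) + centreNorm² i ≡ dist² F (pt j) (centre i) + cornerCost i
    price·bundle i j = begin
      (p₁ * e₁ + p₂ * e₂ + 1# * (s₁ + s₂)) + (a₁ i * a₁ i + a₂ i * a₂ i)
        ≡⟨ regroup (p₁ * e₁) (p₂ * e₂) s₁ s₂ (a₁ i * a₁ i) (a₂ i * a₂ i) ⟩
      (p₁ * e₁ + s₁ + a₁ i * a₁ i) + (p₂ * e₂ + s₂ + a₂ i * a₂ i)
        ≡⟨ cong₂ _+_ (coordinate-identity L H (proj₁ (centre i)) (proj₁ (pt j)))
                     (coordinate-identity L H (proj₂ (centre i)) (proj₂ (pt j))) ⟩
      (d₁ + p₁ * (H − L)) + (d₂ + p₂ * (H − L))
        ≡⟨ interchange d₁ (p₁ * (H − L)) d₂ (p₂ * (H − L)) ⟩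
      (d₁ + d₂) + (p₁ * (H − L) + p₂ * (H − L)) ∎
      where
      p₁ p₂ e₁ e₂ s₁ s₂ d₁ d₂ : R
      p₁ = price i zero
      p₂ = price i (suc zero)
      e₁ = bundle j zero
      e₂ = bundle j (suc zero)
      s₁ = (proj₁ (pt j) − L) * (proj₁ (pt j) − L)
      s₂ = (proj₂ (pt j) − L) * (proj₂ (pt j) − L)
      d₁ = (proj₁ (pt j) − proj₁ (centre i)) * (proj₁ (pt j) − proj₁ (centre i))
      d₂ = (proj₂ (pt j) − proj₂ (centre i)) * (proj₂ (pt j) − proj₂ (centre i))
      regroup : ∀ q₁ q₂ s₁ s₂ t₁ t₂ → (q₁ + q₂ + 1# * (s₁ + s₂)) + (t₁ + t₂) ≡ (q₁ + s₁ + t₁) + (q₂ + s₂ + t₂)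
      regroup = solve 6 (λ q₁ q₂ s₁ s₂ t₁ t₂ →
        (q₁ :+ q₂ :+ con 1 :* (s₁ :+ s₂)) :+ (t₁ :+ t₂) := (q₁ :+ s₁ :+ t₁) :+ (q₂ :+ s₂ :+ t₂)) refl

    revealed⇔inDisc : ∀ i j → revPrefGraph F consumerData i j ⇔ odGraph F Δ i j
    revealed⇔inDisc i j = ⇔-id _ ×-⇔ ≤-transport-⇔ (price·bundle i j) price·own-bundle
      where
      price·own-bundle : _·_ F (price i) (bundle i) + centreNorm² i ≡ sq F (Disc.radius (dsc i)) + cornerCost i
      price·own-bundle = trans (price·bundle i i) (cong (_+ cornerCost i) (onBoundary i))

lemma6 : (F : CompleteOrderedField) → (n : ℕ) → (D : Digraph n) →
    IsOrientedDiscGraph F D →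
    Σ (ConsumerData F n) (λ C → revPrefGraph F C ≅ D)
lemma6 F n D (Δ , D⇔odGraph) =
  consumerData , ↔-id (Fin n) , λ i j → ⇔-sym (D⇔odGraph i j) ⇔-∘ revealed⇔inDisc i j
  where open RevealedPreference F Δ
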